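{- For any positive integers $q$ and $k$ with $k\ge2$ and any $A\subseteq\mathbb{N}$, the Cayley graph $G(\mathbb{Z}^2,\pm AD_{q,k})$ is (isomorphic to) a subgraph of the graph with vertex set $\mathbb{R}^2$ in which two points are adjacent if their Euclidean distance lies in $A$.
   Context: $X_{q,k}=\prod_{j=1}^{k-1}(q^{k+j}+q^{k-j}+1)$, and $D_{q,k}\subseteq\mathbb{Z}^2$ consists of the $k-1$ points $\frac{X_{q,k}}{q^{k+j}+q^{k-j}+1}(q^{k+j}-q^{k-j},\,-q^j-2q^k)$, $j=1,\dots,k-1$. $\pm AD_{q,k}$ is the set of all points $\pm ad$ with $a\in A$, $d\in D_{q,k}$. For $C'\subseteq\mathbb{Z}^2\setminus\{0\}$ with $C'=-C'$, the Cayley graph $G(\mathbb{Z}^2,C')$ has vertex set $\mathbb{Z}^2$, with $u,v$ adjacent iff $v-u\in C'$. $\mathbb{N}=\{1,2,3,\dots\}$. -}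

module Defs where

open import Level using (0ℓ)
open import Data.Nat as ℕ using (ℕ; zero; suc; _∸_; _^_; _/_)
open import Data.Integer as ℤ using (ℤ; +_; -[1+_])
open import Data.List using (List; map; upTo)
open import Data.Nat.ListAction using (product)
open import Data.Product using (_×_; _,_; ∃; ∃-syntax)
open import Data.Sum using (_⊎_)
open import Relation.Nullary using (¬_)
open import Relation.Binary.PropositionalEquality using (_≡_)
open import Relation.Binary.Structures using (IsTotalOrder)
open import Algebra.Structures using (IsCommutativeRing)

-- A model of the real numbers: a complete (Dedekind / least-upper-bound)
-- totally ordered field.  Equality on the carrier is propositional.

record CompleteOrderedField : Set₁ where
  infixl 6 _+_
  infixl 7 _*_
  infix 4 _≤_
  field
    ℝ   : Set
    _+_ : ℝ → ℝ → ℝ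
    _*_ : ℝ → ℝ → ℝ
    -_  : ℝ → ℝ
    0#  : ℝ
    1#  : ℝ
    isCommutativeRing : IsCommutativeRing _≡_ _+_ _*_ -_ 0# 1#
    0≢1     : ¬ (0# ≡ 1#)
    inverse : ∀ x → ¬ (x ≡ 0#) → ∃[ y ] (x * y ≡ 1#)
    _≤_          : ℝ → ℝ → Set
    isTotalOrder : IsTotalOrder _≡_ _≤_
    +-mono-≤  : ∀ {x y} z → x ≤ y → x + z ≤ y + z
    *-nonneg  : ∀ {x y} → 0# ≤ x → 0# ≤ y → 0# ≤ x * y
    sup : (P : ℝ → Set) → ∃ P → (∃[ b ] (∀ x → P x → x ≤ b)) →
          ∃[ s ] ((∀ x → P x → x ≤ s) × (∀ b → (∀ x → P x → x ≤ b) → s ≤ b))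

module _ (R : CompleteOrderedField) where
  open CompleteOrderedField R

  fromℕ : ℕ → ℝ
  fromℕ zero    = 0#
  fromℕ (suc n) = 1# + fromℕ n

  Point : Set
  Point = ℝ × ℝ

  IsDistance : Point → Point → ℝ → Set
  IsDistance (x , y) (x′ , y′) r =
    (0# ≤ r) × (r * r ≡ (x + - x′) * (x + - x′) + (y + - y′) * (y + - y′))

  DistAdj : (ℕ → Set) → Point → Point → Set
  DistAdj A p p′ = ∃[ a ] (A a × IsDistance p p′ (fromℕ a))

-- c q k j = q^{k+j} + q^{k-j} + 1  (used for 1 ≤ j ≤ k-1)
c : ℕ → ℕ → ℕ → ℕ
c q k j = suc (q ^ (k ℕ.+ j) ℕ.+ q ^ (k ∸ j))

X : ℕ → ℕ → ℕ
X q k = product (map (λ i → c q k (suc i)) (upTo (k ∸ 1)))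

ℤ² : Set
ℤ² = ℤ × ℤ

_-ᶻ_ : ℤ² → ℤ² → ℤ²
(x , y) -ᶻ (x′ , y′) = (x ℤ.- x′ , y ℤ.- y′)

_·ᶻ_ : ℤ → ℤ² → ℤ²
s ·ᶻ (x , y) = (s ℤ.* x , s ℤ.* y)

-- the point d_j of D_{q,k}:  (X/c_j) (q^{k+j} - q^{k-j}, -q^j - 2q^k)
-- (X/c_j is an exact quotient since c_j divides X for 1 ≤ j ≤ k-1)
d : ℕ → ℕ → ℕ → ℤ²
d q k j = (+ (X q k / c q k j)) ·ᶻ
          ( + (q ^ (k ℕ.+ j)) ℤ.- + (q ^ (k ∸ j))
          , ℤ.- (+ (q ^ j) ℤ.+ + 2 ℤ.* + (q ^ k)) )

In±AD : ℕ → ℕ → (ℕ → Set) → ℤ² → Set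
In±AD q k A w =
  ∃[ a ] (A a × ∃[ j ] ((1 ℕ.≤ j) × (j ℕ.< k) ×
     ((w ≡ (+ a) ·ᶻ d q k j) ⊎ (w ≡ (ℤ.- (+ a)) ·ᶻ d q k j))))

CayleyAdj : ℕ → ℕ → (ℕ → Set) → ℤ² → ℤ² → Set
CayleyAdj q k A u v = In±AD q k A (v -ᶻ u)

-- Put m = 2 q^k and N = m X_{q,k}. The linear map
-- (x , y) ↦ (m x + y , √(m² − 1) y) / N is injective on ℤ², and the squared length of the
-- image of (x , y) is Q(x , y) / N² with Q(x , y) = (m x + y)² + (m² − 1) y². Writing
-- b = q^{k-j} and u = q^j, we have m = 2bu and d_j = (X/c_j) (b u² − b , −(u + 2bu)), and a
-- polynomial identity gives Q(d_j) = N². Hence Q(±a d_j) = a² N², i.e. every Cayley edge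
-- becomes a segment of length a. The only analytic input is √(m² − 1), obtained as the
-- supremum of {x ≥ 0 : x² ≤ m² − 1}.

module Submission where

open import Defs
open import Data.Nat using (ℕ; _≤_)
open import Data.Product using (_×_; ∃-syntax)
open import Relation.Binary.PropositionalEquality using (_≡_)
open import Function.Definitions using (Injective)

open import Level using (0ℓ)
open import Relation.Binary.PropositionalEquality using (refl; sym; trans; cong; cong₂; subst; subst₂; module ≡-Reasoning)
open import Data.Product using (_,_; proj₁; proj₂)
open import Data.Sum using (inj₁; inj₂)
import Data.Maybe as Maybe
open import Data.Empty using (⊥-elim)
open import Relation.Nullary using (¬_)
open import Relation.Nullary.Decidable using (dec⇒maybe)
open import Data.Nat as ℕ using (zero; suc; _∸_; _^_; _/_; s≤s; z≤n)
import Data.Nat.Properties as ℕP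
open import Data.Nat.Divisibility using (_∣_)
open import Data.Nat.DivMod using (m/n*n≡m)
open import Data.Nat.ListAction.Properties using (∈⇒∣product; product≢0)
open import Data.List using (upTo)
open import Data.List.Relation.Unary.All using (universal)
open import Data.List.Relation.Unary.All.Properties using (map⁺)
open import Data.List.Membership.Propositional.Properties using (∈-map⁺; ∈-upTo⁺)
open import Data.Integer as ℤ using (ℤ; +_; -[1+_]; _⊖_)
import Data.Integer.Properties as ℤP
open import Data.Integer.Solver using (module +-*-Solver)
open import Relation.Binary.Bundles using (Poset)
open import Relation.Binary.Structures using (IsTotalOrder)
open import Algebra.Bundles using (CommutativeRing)
open import Algebra.Solver.Ring.AlmostCommutativeRing using (fromCommutativeRing; _-Raw-AlmostCommutative⟶_)
import Algebra.Solver.Ring as RingSolver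
import Algebra.Properties.Ring as RingProperties
import Algebra.Properties.AbelianGroup as AbelianGroupProperties
import Relation.Binary.Reasoning.PartialOrder

c∣X : ∀ {q k j} → 1 ≤ j → j ℕ.< k → c q k j ∣ X q k
c∣X {q} {suc k} (s≤s z≤n) (s≤s i<k) =
  ∈⇒∣product (∈-map⁺ (λ i → c q (suc k) (suc i)) (∈-upTo⁺ i<k))

^-split : ∀ q {k j} → j ≤ k → q ^ k ≡ q ^ (k ∸ j) ℕ.* q ^ j
^-split q {k} {j} j≤k = begin
  q ^ k                   ≡⟨ cong (q ^_) (ℕP.m∸n+n≡m j≤k) ⟨
  q ^ (k ∸ j ℕ.+ j)       ≡⟨ ℕP.^-distribˡ-+-* q (k ∸ j) j ⟩
  q ^ (k ∸ j) ℕ.* q ^ j   ∎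
  where open ≡-Reasoning

X≢0 : ∀ q k → ℕ.NonZero (X q k)
X≢0 q k = product≢0 (map⁺ (universal (λ _ → _) (upTo (k ∸ 1))))

N : ℕ → ℕ → ℕ
N q k = 2 ℕ.* q ^ k ℕ.* X q k

N≢0 : ∀ {q} k → 1 ≤ q → ℕ.NonZero (N q k)
N≢0 {q} k 1≤q = ℕP.m*n≢0 (2 ℕ.* q ^ k) (X q k)
  {{ℕP.m*n≢0 2 (q ^ k) {{_}} {{ℕP.m^n≢0 q k {{ℕ.>-nonZero 1≤q}}}}}} {{X≢0 q k}}

module _ where
  open import Data.Integer using (_+_; _*_; -_; _-_)

  shear : ℤ → ℤ² → ℤ
  shear m (x , y) = m * x + y

  shear-sub : ∀ m u v → shear m (v -ᶻ u) ≡ shear m v - shear m u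
  shear-sub m (xu , yu) (xv , yv) = solve 5 (λ m xu yu xv yv →
    m :* (xv :- xu) :+ (yv :- yu) := (m :* xv :+ yv) :- (m :* xu :+ yu)) refl m xu yu xv yv
    where open +-*-Solver

  Q : ℤ → ℤ² → ℤ
  Q m w = shear m w * shear m w + (m * m - + 1) * (proj₂ w * proj₂ w)

  Q-scale : ∀ m s w → Q m (s ·ᶻ w) ≡ s * s * Q m w
  Q-scale m s (x , y) = solve 4 (λ m s x y →
      (m :* (s :* x) :+ s :* y) :* (m :* (s :* x) :+ s :* y) :+ (m :* m :- con (+ 1)) :* ((s :* y) :* (s :* y))
    := s :* s :* ((m :* x :+ y) :* (m :* x :+ y) :+ (m :* m :- con (+ 1)) :* (y :* y))) refl m s x y
    where open +-*-Solver

  Q-norm-identity : ∀ b u g →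
    let m = + 2 * (b * u) in
    Q m (g ·ᶻ (b * u * u - b , - (u + + 2 * (b * u)))) ≡
    (m * (g * (+ 1 + (b * u * u + b)))) * (m * (g * (+ 1 + (b * u * u + b))))
  Q-norm-identity = solve 3 (λ b u g →
    let m = con (+ 2) :* (b :* u)
        x = g :* (b :* u :* u :- b)
        y = g :* (:- (u :+ con (+ 2) :* (b :* u)))
        n = m :* (g :* (con (+ 1) :+ (b :* u :* u :+ b)))
    in (m :* x :+ y) :* (m :* x :+ y) :+ (m :* m :- con (+ 1)) :* (y :* y) := n :* n) refl
    where open +-*-Solver

  Q-d : ∀ {q k j} → 1 ≤ j → j ℕ.< k →
        Q (+ (2 ℕ.* q ^ k)) (d q k j) ≡ + N q k * + N q k
  Q-d {q} {k} {j} 1≤j j<k = begin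
    Q (+ (2 ℕ.* q ^ k)) (d q k j)
      ≡⟨ cong₂ Q m≡ (cong₂ (λ p r → g ·ᶻ (p - b , - (u + + 2 * r))) q^[k+j]≡ q^k≡) ⟩
    Q (+ 2 * (b * u)) (g ·ᶻ (b * u * u - b , - (u + + 2 * (b * u))))
      ≡⟨ Q-norm-identity b u g ⟩
    (+ 2 * (b * u) * (g * (+ 1 + (b * u * u + b)))) * (+ 2 * (b * u) * (g * (+ 1 + (b * u * u + b))))
      ≡⟨ cong (λ n → n * n) (sym n≡) ⟩
    + N q k * + N q k ∎
    where
    open ≡-Reasoning
    b = + (q ^ (k ∸ j))
    u = + (q ^ j)
    g = + (X q k / c q k j)
    q^k≡ : + (q ^ k) ≡ b * u
    q^k≡ = trans (cong +_ (^-split q (ℕP.<⇒≤ j<k))) (ℤP.pos-* (q ^ (k ∸ j)) (q ^ j))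
    q^[k+j]≡ : + (q ^ (k ℕ.+ j)) ≡ b * u * u
    q^[k+j]≡ = trans (cong +_ (ℕP.^-distribˡ-+-* q k j)) (trans (ℤP.pos-* (q ^ k) (q ^ j)) (cong (_* u) q^k≡))
    m≡ : + (2 ℕ.* q ^ k) ≡ + 2 * (b * u)
    m≡ = trans (ℤP.pos-* 2 (q ^ k)) (cong (+ 2 *_) q^k≡)
    X≡ : + X q k ≡ g * (+ 1 + (b * u * u + b))
    X≡ = begin
      + X q k                                        ≡⟨ cong +_ (m/n*n≡m (c∣X 1≤j j<k)) ⟨
      + (X q k / c q k j ℕ.* c q k j)                ≡⟨ ℤP.pos-* (X q k / c q k j) (c q k j) ⟩
      g * + c q k j                                  ≡⟨ cong (g *_) (ℤP.pos-+ 1 (q ^ (k ℕ.+ j) ℕ.+ q ^ (k ∸ j))) ⟩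
      g * (+ 1 + + (q ^ (k ℕ.+ j) ℕ.+ q ^ (k ∸ j)))  ≡⟨ cong (λ z → g * (+ 1 + z)) (ℤP.pos-+ (q ^ (k ℕ.+ j)) (q ^ (k ∸ j))) ⟩
      g * (+ 1 + (+ (q ^ (k ℕ.+ j)) + b))            ≡⟨ cong (λ z → g * (+ 1 + (z + b))) q^[k+j]≡ ⟩
      g * (+ 1 + (b * u * u + b))                    ∎
    n≡ : + N q k ≡ + 2 * (b * u) * (g * (+ 1 + (b * u * u + b)))
    n≡ = trans (ℤP.pos-* (2 ℕ.* q ^ k) (X q k)) (cong₂ _*_ m≡ X≡)

  Q-multiple-d : ∀ {q k j w} s a → 1 ≤ j → j ℕ.< k → w ≡ s ·ᶻ d q k j → s * s ≡ + a * + a →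
                 Q (+ (2 ℕ.* q ^ k)) w ≡ + a * + a * (+ N q k * + N q k)
  Q-multiple-d {q} {k} {j} s a 1≤j j<k refl s*s≡ = begin
    Q (+ (2 ℕ.* q ^ k)) (s ·ᶻ d q k j)         ≡⟨ Q-scale (+ (2 ℕ.* q ^ k)) s (d q k j) ⟩
    s * s * Q (+ (2 ℕ.* q ^ k)) (d q k j)      ≡⟨ cong₂ _*_ s*s≡ (Q-d 1≤j j<k) ⟩
    + a * + a * (+ N q k * + N q k)            ∎
    where open ≡-Reasoning

  Q-∈±AD : ∀ {q k A w} → In±AD q k A w → ∃[ a ] (A a × Q (+ (2 ℕ.* q ^ k)) w ≡ + a * + a * (+ N q k * + N q k))
  Q-∈±AD (a , Aa , j , 1≤j , j<k , inj₁ w≡) = a , Aa , Q-multiple-d (+ a) a 1≤j j<k w≡ refl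
  Q-∈±AD (a , Aa , j , 1≤j , j<k , inj₂ w≡) = a , Aa , Q-multiple-d (- + a) a 1≤j j<k w≡ (solve 1 (λ a → :- a :* :- a := a :* a) refl (+ a))
    where open +-*-Solver

module OrderedFieldTheory (R : CompleteOrderedField) where
  open CompleteOrderedField R renaming (_≤_ to _≤ᵣ_)

  infixl 6 _-_
  _-_ : ℝ → ℝ → ℝ
  x - y = x + - y

  commutativeRing : CommutativeRing 0ℓ 0ℓ
  commutativeRing = record { isCommutativeRing = isCommutativeRing }

  open CommutativeRing commutativeRing
    using (+-assoc; +-comm; +-identityˡ; +-identityʳ; *-assoc; *-comm; *-identityˡ; *-identityʳ; zeroʳ; -‿inverseʳ; distribʳ; zeroˡ; ring; +-abelianGroup)
  open RingProperties ring using (-‿distribˡ-*; -‿distribʳ-*)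
  open AbelianGroupProperties +-abelianGroup using (⁻¹-∙-comm; xyx⁻¹≈y; ε⁻¹≈ε; ⁻¹-involutive)

  fromℕ-+ : ∀ m n → fromℕ R (m ℕ.+ n) ≡ fromℕ R m + fromℕ R n
  fromℕ-+ zero    n = sym (+-identityˡ _)
  fromℕ-+ (suc m) n = trans (cong (_+_ 1#) (fromℕ-+ m n)) (sym (+-assoc 1# _ _))

  fromℕ-* : ∀ m n → fromℕ R (m ℕ.* n) ≡ fromℕ R m * fromℕ R n
  fromℕ-* zero    n = sym (zeroˡ _)
  fromℕ-* (suc m) n = begin
    fromℕ R (n ℕ.+ m ℕ.* n)                   ≡⟨ fromℕ-+ n (m ℕ.* n) ⟩
    fromℕ R n + fromℕ R (m ℕ.* n)             ≡⟨ cong₂ _+_ (sym (*-identityˡ _)) (fromℕ-* m n) ⟩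
    1# * fromℕ R n + fromℕ R m * fromℕ R n    ≡⟨ distribʳ _ _ _ ⟨
    (1# + fromℕ R m) * fromℕ R n              ∎
    where open ≡-Reasoning

  ι : ℤ → ℝ
  ι (+ n)    = fromℕ R n
  ι -[1+ n ] = - fromℕ R (suc n)

  ι-⊖ : ∀ m n → ι (m ⊖ n) ≡ fromℕ R m - fromℕ R n
  ι-⊖ m       zero    = sym (trans (cong (_+_ (fromℕ R m)) ε⁻¹≈ε) (+-identityʳ _))
  ι-⊖ zero    (suc n) = sym (+-identityˡ _)
  ι-⊖ (suc m) (suc n) = begin
    ι (suc m ⊖ suc n)                      ≡⟨ cong ι (ℤP.[1+m]⊖[1+n]≡m⊖n m n) ⟩
    ι (m ⊖ n)                              ≡⟨ ι-⊖ m n ⟩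
    a - b                                  ≡⟨ cong (_- b) (xyx⁻¹≈y 1# a) ⟨
    1# + a - 1# - b                        ≡⟨ +-assoc (1# + a) (- 1#) (- b) ⟩
    1# + a + (- 1# - b)                    ≡⟨ cong (_+_ (1# + a)) (⁻¹-∙-comm 1# b) ⟩
    1# + a - (1# + b)                      ∎
    where
    open ≡-Reasoning
    a = fromℕ R m
    b = fromℕ R n

  ι-neg : ∀ i → ι (ℤ.- i) ≡ - ι i
  ι-neg (+ zero)    = sym ε⁻¹≈ε
  ι-neg (+ (suc n)) = refl
  ι-neg -[1+ n ]    = sym (⁻¹-involutive _)

  ι-+ : ∀ i j → ι (i ℤ.+ j) ≡ ι i + ι j
  ι-+ (+ m)    (+ n)    = fromℕ-+ m n
  ι-+ (+ m)    -[1+ n ] = ι-⊖ m (suc n)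
  ι-+ -[1+ m ] (+ n)    = trans (ι-⊖ n (suc m)) (+-comm _ _)
  ι-+ -[1+ m ] -[1+ n ] = begin
    - fromℕ R (suc (suc (m ℕ.+ n)))          ≡⟨ cong (λ k → - fromℕ R (suc k)) (ℕP.+-suc m n) ⟨
    - fromℕ R (suc m ℕ.+ suc n)              ≡⟨ cong -_ (fromℕ-+ (suc m) (suc n)) ⟩
    - (fromℕ R (suc m) + fromℕ R (suc n))    ≡⟨ ⁻¹-∙-comm _ _ ⟨
    - fromℕ R (suc m) - fromℕ R (suc n)      ∎
    where open ≡-Reasoning

  ι-*ˡ-pos : ∀ m j → ι (+ m ℤ.* j) ≡ fromℕ R m * ι j
  ι-*ˡ-pos m (+ n)    = trans (cong ι (sym (ℤP.pos-* m n))) (fromℕ-* m n)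
  ι-*ˡ-pos m -[1+ n ] = begin
    ι (+ m ℤ.* ℤ.- + suc n)          ≡⟨ cong ι (ℤP.neg-distribʳ-* (+ m) (+ suc n)) ⟨
    ι (ℤ.- (+ m ℤ.* + suc n))        ≡⟨ ι-neg (+ m ℤ.* + suc n) ⟩
    - ι (+ m ℤ.* + suc n)            ≡⟨ cong -_ (ι-*ˡ-pos m (+ suc n)) ⟩
    - (fromℕ R m * ι (+ suc n))      ≡⟨ -‿distribʳ-* _ _ ⟩
    fromℕ R m * - ι (+ suc n)        ∎
    where open ≡-Reasoning

  ι-* : ∀ i j → ι (i ℤ.* j) ≡ ι i * ι j
  ι-* (+ m)    j = ι-*ˡ-pos m j
  ι-* -[1+ m ] j = begin
    ι (ℤ.- + suc m ℤ.* j)            ≡⟨ cong ι (ℤP.neg-distribˡ-* (+ suc m) j) ⟨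
    ι (ℤ.- (+ suc m ℤ.* j))          ≡⟨ ι-neg (+ suc m ℤ.* j) ⟩
    - ι (+ suc m ℤ.* j)              ≡⟨ cong -_ (ι-*ˡ-pos (suc m) j) ⟩
    - (ι (+ suc m) * ι j)            ≡⟨ -‿distribˡ-* _ _ ⟩
    - ι (+ suc m) * ι j              ∎
    where open ≡-Reasoning

  ι-sub : ∀ i j → ι (i ℤ.- j) ≡ ι i - ι j
  ι-sub i j = trans (ι-+ i (ℤ.- j)) (cong (_+_ (ι i)) (ι-neg j))

  ι-Q : ∀ i x y → ι (Q i (x , y)) ≡ ι (shear i (x , y)) * ι (shear i (x , y)) + ι (i ℤ.* i ℤ.- + 1) * (ι y * ι y)
  ι-Q i x y = trans (ι-+ (p ℤ.* p) (T ℤ.* (y ℤ.* y)))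
                    (cong₂ _+_ (ι-* p p) (trans (ι-* T (y ℤ.* y)) (cong (_*_ (ι T)) (ι-* y y))))
    where
    p = shear i (x , y)
    T = i ℤ.* i ℤ.- + 1

  ι-morphism : ℤ.+-*-rawRing -Raw-AlmostCommutative⟶ fromCommutativeRing commutativeRing
  ι-morphism = record
    { ⟦_⟧ = ι ; +-homo = ι-+ ; *-homo = ι-* ; -‿homo = ι-neg
    ; 0-homo = refl ; 1-homo = +-identityʳ 1# }

  open RingSolver ℤ.+-*-rawRing (fromCommutativeRing commutativeRing) ι-morphism
    (λ i j → Maybe.map (cong ι) (dec⇒maybe (i ℤ.≟ j)))
    using (solve; _:+_; _:*_; :-_; _:-_; con; _:=_)

  open IsTotalOrder isTotalOrder using (total; antisym) renaming (refl to ≤-refl; trans to ≤-trans)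

  poset : Poset 0ℓ 0ℓ 0ℓ
  poset = record { isPartialOrder = IsTotalOrder.isPartialOrder isTotalOrder }

  module ≤-Reasoning = Relation.Binary.Reasoning.PartialOrder poset

  x≤y⇒0≤y-x : ∀ {x y} → x ≤ᵣ y → 0# ≤ᵣ y - x
  x≤y⇒0≤y-x {x} p = subst (_≤ᵣ _) (-‿inverseʳ x) (+-mono-≤ (- x) p)

  0≤y-x⇒x≤y : ∀ {x y} → 0# ≤ᵣ y - x → x ≤ᵣ y
  0≤y-x⇒x≤y {x} {y} p = subst₂ _≤ᵣ_ (+-identityˡ x) (solve 2 (λ x y → y :- x :+ x := y) refl x y) (+-mono-≤ x p)

  x≤0⇒0≤-x : ∀ {x} → x ≤ᵣ 0# → 0# ≤ᵣ - x
  x≤0⇒0≤-x p = subst (0# ≤ᵣ_) (+-identityˡ _) (x≤y⇒0≤y-x p)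

  0≤-x⇒x≤0 : ∀ {x} → 0# ≤ᵣ - x → x ≤ᵣ 0#
  0≤-x⇒x≤0 p = 0≤y-x⇒x≤y (subst (0# ≤ᵣ_) (sym (+-identityˡ _)) p)

  +-nonneg : ∀ {x y} → 0# ≤ᵣ x → 0# ≤ᵣ y → 0# ≤ᵣ x + y
  +-nonneg {x} {y} p q = ≤-trans p (subst₂ _≤ᵣ_ (+-identityˡ x) (+-comm y x) (+-mono-≤ x q))

  *-monoʳ-≤ : ∀ {x y} z → 0# ≤ᵣ z → x ≤ᵣ y → x * z ≤ᵣ y * z
  *-monoʳ-≤ {x} {y} z 0≤z x≤y = 0≤y-x⇒x≤y (subst (0# ≤ᵣ_)
    (solve 3 (λ x y z → (y :- x) :* z := y :* z :- x :* z) refl x y z) (*-nonneg (x≤y⇒0≤y-x x≤y) 0≤z))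

  0≤1 : 0# ≤ᵣ 1#
  0≤1 with total 0# 1#
  ... | inj₁ 0≤1 = 0≤1
  ... | inj₂ 1≤0 = ⊥-elim (0≢1 (antisym 0≤[-1]² 1≤0))
    where
    0≤[-1]² : 0# ≤ᵣ 1#
    0≤[-1]² = subst (0# ≤ᵣ_) (trans (solve 1 (λ x → :- x :* :- x := x :* x) refl 1#) (*-identityˡ 1#))
                (*-nonneg (x≤0⇒0≤-x 1≤0) (x≤0⇒0≤-x 1≤0))

  1≤x⇒x≢0 : ∀ {x} → 1# ≤ᵣ x → ¬ (x ≡ 0#)
  1≤x⇒x≢0 1≤x refl = 0≢1 (antisym 0≤1 1≤x)

  fromℕ-nonneg : ∀ n → 0# ≤ᵣ fromℕ R n
  fromℕ-nonneg zero    = ≤-refl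
  fromℕ-nonneg (suc n) = +-nonneg 0≤1 (fromℕ-nonneg n)

  nonneg-inverse : ∀ x → 1# ≤ᵣ x → ∃[ y ] (x * y ≡ 1# × 0# ≤ᵣ y)
  nonneg-inverse x 1≤x with inverse x (1≤x⇒x≢0 1≤x)
  ... | y , xy≡1 with total 0# y
  ...   | inj₁ 0≤y = y , xy≡1 , 0≤y
  ...   | inj₂ y≤0 = ⊥-elim (0≢1 (antisym 0≤1 1≤0))
    where
    1≤0 : 1# ≤ᵣ 0#
    1≤0 = 0≤-x⇒x≤0 (subst (0# ≤ᵣ_) (trans (sym (-‿distribʳ-* x y)) (cong -_ xy≡1))
            (*-nonneg (≤-trans 0≤1 1≤x) (x≤0⇒0≤-x y≤0)))

  x≤y⇒x-y≤0 : ∀ {x y} → x ≤ᵣ y → x - y ≤ᵣ 0#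
  x≤y⇒x-y≤0 {x} {y} p = 0≤-x⇒x≤0 (subst (0# ≤ᵣ_) (solve 2 (λ x y → y :- x := :- (x :- y)) refl x y) (x≤y⇒0≤y-x p))

  x-y≤0⇒x≤y : ∀ {x y} → x - y ≤ᵣ 0# → x ≤ᵣ y
  x-y≤0⇒x≤y {x} {y} p = 0≤y-x⇒x≤y (subst (0# ≤ᵣ_) (solve 2 (λ x y → :- (x :- y) := y :- x) refl x y) (x≤0⇒0≤-x p))

  x≤x+y : ∀ {x y} → 0# ≤ᵣ y → x ≤ᵣ x + y
  x≤x+y {x} {y} p = 0≤y-x⇒x≤y (subst (0# ≤ᵣ_) (solve 2 (λ x y → y := x :+ y :- x) refl x y) p)

  1≤fromℕ-suc : ∀ n → 1# ≤ᵣ fromℕ R (suc n)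
  1≤fromℕ-suc n = x≤x+y (fromℕ-nonneg n)

  x+y≤x⇒y≤0 : ∀ {x y} → x + y ≤ᵣ x → y ≤ᵣ 0#
  x+y≤x⇒y≤0 {x} {y} p = subst₂ _≤ᵣ_ (solve 2 (λ x y → x :+ y :- x := y) refl x y) (-‿inverseʳ x) (+-mono-≤ (- x) p)

  +-nonpos : ∀ {x y} → x ≤ᵣ 0# → y ≤ᵣ 0# → x + y ≤ᵣ 0#
  +-nonpos {x} {y} x≤0 y≤0 = ≤-trans (subst (x + y ≤ᵣ_) (+-identityˡ y) (+-mono-≤ y x≤0)) y≤0

  *-nonpos : ∀ {x} z → 0# ≤ᵣ z → x ≤ᵣ 0# → z * x ≤ᵣ 0#
  *-nonpos {x} z 0≤z x≤0 = subst₂ _≤ᵣ_ (*-comm x z) (zeroˡ z) (*-monoʳ-≤ z 0≤z x≤0)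

  module SquareRoot {t : ℝ} (1≤t : 1# ≤ᵣ t) where

    0≤t : 0# ≤ᵣ t
    0≤t = ≤-trans 0≤1 1≤t

    SquareBelow : ℝ → Set
    SquareBelow x = 0# ≤ᵣ x × x * x ≤ᵣ t

    squareBelow⇒≤t : ∀ x → SquareBelow x → x ≤ᵣ t
    squareBelow⇒≤t x (0≤x , x²≤t) with total x 1#
    ... | inj₁ x≤1 = ≤-trans x≤1 1≤t
    ... | inj₂ 1≤x = begin
      x       ≡⟨ *-identityˡ x ⟨
      1# * x  ≤⟨ *-monoʳ-≤ x 0≤x 1≤x ⟩
      x * x   ≤⟨ x²≤t ⟩
      t       ∎
      where open ≤-Reasoning

    module _ {s : ℝ} (upper : ∀ x → SquareBelow x → x ≤ᵣ s) where

      1≤s : 1# ≤ᵣ s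
      1≤s = upper 1# (0≤1 , subst (_≤ᵣ t) (sym (*-identityˡ 1#)) 1≤t)

      0≤s : 0# ≤ᵣ s
      0≤s = ≤-trans 0≤1 1≤s

      1≤4s : 1# ≤ᵣ s + s + s + s
      1≤4s = begin
        1#                ≤⟨ 1≤s ⟩
        s                 ≤⟨ x≤x+y (+-nonneg (+-nonneg 0≤s 0≤s) 0≤s) ⟩
        s + (s + s + s)   ≡⟨ solve 1 (λ s → s :+ (s :+ s :+ s) := s :+ s :+ s :+ s) refl s ⟩
        s + s + s + s     ∎
        where open ≤-Reasoning

      1≤2s+1+t : 1# ≤ᵣ s + s + 1# + t
      1≤2s+1+t = begin
        1#                  ≤⟨ x≤x+y (+-nonneg (+-nonneg 0≤s 0≤s) 0≤t) ⟩
        1# + (s + s + t)    ≡⟨ solve 3 (λ o s t → o :+ (s :+ s :+ t) := s :+ s :+ o :+ t) refl 1# s t ⟩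
        s + s + 1# + t      ∎
        where open ≤-Reasoning

      -- If s² > t, then s − (s² − t)/(4s) is a smaller upper bound.
      module Overshoot (least : ∀ b → (∀ x → SquareBelow x → x ≤ᵣ b) → s ≤ᵣ b) (t≤s² : t ≤ᵣ s * s)
                       {h : ℝ} (4s*h≡1 : (s + s + s + s) * h ≡ 1#) (0≤h : 0# ≤ᵣ h) where

        e = s * s - t
        ε = e * h
        y = s - ε

        0≤e : 0# ≤ᵣ e
        0≤e = x≤y⇒0≤y-x t≤s²

        0≤ε : 0# ≤ᵣ ε
        0≤ε = *-nonneg 0≤e 0≤h

        e≡[s+s]ε+[s+s]ε : e ≡ (s + s) * ε + (s + s) * ε
        e≡[s+s]ε+[s+s]ε = begin
          e                          ≡⟨ *-identityʳ e ⟨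
          e * 1#                     ≡⟨ cong (e *_) 4s*h≡1 ⟨
          e * ((s + s + s + s) * h)  ≡⟨ solve 3 (λ s e h → e :* ((s :+ s :+ s :+ s) :* h) := (s :+ s) :* (e :* h) :+ (s :+ s) :* (e :* h)) refl s e h ⟩
          (s + s) * ε + (s + s) * ε  ∎
          where open ≡-Reasoning

        [s+s]ε≤0⇒e≤0 : (s + s) * ε ≤ᵣ 0# → e ≤ᵣ 0#
        [s+s]ε≤0⇒e≤0 p = subst (_≤ᵣ 0#) (sym e≡[s+s]ε+[s+s]ε) (+-nonpos p p)

        y*y-t≡[s+s]ε+ε*ε : y * y - t ≡ (s + s) * ε + ε * ε
        y*y-t≡[s+s]ε+ε*ε = begin
          y * y - t                                          ≡⟨ solve 3 (λ s t ε → (s :- ε) :* (s :- ε) :- t := (s :* s :- t) :- (s :+ s) :* ε :+ ε :* ε) refl s t ε ⟩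
          e - (s + s) * ε + ε * ε                            ≡⟨ cong (λ z → z - (s + s) * ε + ε * ε) e≡[s+s]ε+[s+s]ε ⟩
          (s + s) * ε + (s + s) * ε - (s + s) * ε + ε * ε    ≡⟨ solve 2 (λ a b → a :+ a :- a :+ b := a :+ b) refl ((s + s) * ε) (ε * ε) ⟩
          (s + s) * ε + ε * ε                                ∎
          where open ≡-Reasoning

        0≤y : 0# ≤ᵣ y
        0≤y = subst (0# ≤ᵣ_) y≡ (*-nonneg (+-nonneg (+-nonneg (+-nonneg 0≤s² 0≤s²) 0≤s²) 0≤t) 0≤h)
          where
          0≤s² = *-nonneg 0≤s 0≤s
          y≡ : (s * s + s * s + s * s + t) * h ≡ y
          y≡ = begin
            (s * s + s * s + s * s + t) * h   ≡⟨ solve 3 (λ s t h → (s :* s :+ s :* s :+ s :* s :+ t) :* h := s :* ((s :+ s :+ s :+ s) :* h) :- (s :* s :- t) :* h) refl s t h ⟩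
            s * ((s + s + s + s) * h) - ε     ≡⟨ cong (λ z → s * z - ε) 4s*h≡1 ⟩
            s * 1# - ε                        ≡⟨ cong (_- ε) (*-identityʳ s) ⟩
            y                                 ∎
            where open ≡-Reasoning

        y-upper : ∀ x → SquareBelow x → x ≤ᵣ y
        y-upper x (0≤x , x²≤t) with total x y
        ... | inj₁ x≤y = x≤y
        ... | inj₂ y≤x = subst (x ≤ᵣ_) s≡y (upper x (0≤x , x²≤t))
          where
          y²≤t : y * y ≤ᵣ t
          y²≤t = begin
            y * y   ≤⟨ *-monoʳ-≤ y 0≤y y≤x ⟩
            x * y   ≡⟨ *-comm x y ⟩
            y * x   ≤⟨ *-monoʳ-≤ x 0≤x y≤x ⟩
            x * x   ≤⟨ x²≤t ⟩
            t       ∎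
            where open ≤-Reasoning
          [s+s]ε≤0 : (s + s) * ε ≤ᵣ 0#
          [s+s]ε≤0 = begin
            (s + s) * ε           ≤⟨ x≤x+y (*-nonneg 0≤ε 0≤ε) ⟩
            (s + s) * ε + ε * ε   ≡⟨ y*y-t≡[s+s]ε+ε*ε ⟨
            y * y - t             ≤⟨ x≤y⇒x-y≤0 y²≤t ⟩
            0#                    ∎
            where open ≤-Reasoning
          e≡0 : e ≡ 0#
          e≡0 = antisym ([s+s]ε≤0⇒e≤0 [s+s]ε≤0) 0≤e
          s≡y : s ≡ y
          s≡y = sym (trans (cong (λ z → s - z * h) e≡0) (solve 2 (λ s h → s :- con (+ 0) :* h := s) refl s h))

        s*s≤t : s * s ≤ᵣ t
        s*s≤t = x-y≤0⇒x≤y ([s+s]ε≤0⇒e≤0 (*-nonpos (s + s) (+-nonneg 0≤s 0≤s) ε≤0))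
          where
          ε≤0 : ε ≤ᵣ 0#
          ε≤0 = 0≤-x⇒x≤0 (subst (0# ≤ᵣ_) (solve 2 (λ s ε → s :- ε :- s := :- ε) refl s ε) (x≤y⇒0≤y-x (least y y-upper)))

      -- If s² < t, then s + (t − s²)/(2s + 1 + t) still lies in the set.
      module Undershoot (s²≤t : s * s ≤ᵣ t) {g : ℝ} (G*g≡1 : (s + s + 1# + t) * g ≡ 1#) (0≤g : 0# ≤ᵣ g) where

        e = t - s * s
        G = s + s + 1# + t
        δ = e * g
        y = s + δ

        0≤δ : 0# ≤ᵣ δ
        0≤δ = *-nonneg (x≤y⇒0≤y-x s²≤t) 0≤g

        e≡G*δ : e ≡ G * δ
        e≡G*δ = begin
          e            ≡⟨ *-identityʳ e ⟨
          e * 1#       ≡⟨ cong (e *_) G*g≡1 ⟨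
          e * (G * g)  ≡⟨ solve 3 (λ e G g → e :* (G :* g) := G :* (e :* g)) refl e G g ⟩
          G * δ        ∎
          where open ≡-Reasoning

        δ≤1 : δ ≤ᵣ 1#
        δ≤1 = begin
          e * g    ≤⟨ *-monoʳ-≤ g 0≤g e≤G ⟩
          G * g    ≡⟨ G*g≡1 ⟩
          1#       ∎
          where
          open ≤-Reasoning
          e≤G : e ≤ᵣ G
          e≤G = 0≤y-x⇒x≤y (subst (0# ≤ᵣ_) (solve 3 (λ o s t → s :+ s :+ o :+ s :* s := (s :+ s :+ o :+ t) :- (t :- s :* s)) refl 1# s t)
                  (+-nonneg (+-nonneg (+-nonneg 0≤s 0≤s) 0≤1) (*-nonneg 0≤s 0≤s)))

        t-y*y≡ : t - y * y ≡ (1# * δ - δ * δ) + t * δ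
        t-y*y≡ = begin
          t - y * y                           ≡⟨ solve 3 (λ s t δ → t :- (s :+ δ) :* (s :+ δ) := (t :- s :* s) :- (s :+ s) :* δ :- δ :* δ) refl s t δ ⟩
          e - (s + s) * δ - δ * δ             ≡⟨ cong (λ z → z - (s + s) * δ - δ * δ) e≡G*δ ⟩
          G * δ - (s + s) * δ - δ * δ         ≡⟨ solve 4 (λ o s t δ → (s :+ s :+ o :+ t) :* δ :- (s :+ s) :* δ :- δ :* δ := (o :* δ :- δ :* δ) :+ t :* δ) refl 1# s t δ ⟩
          (1# * δ - δ * δ) + t * δ            ∎
          where open ≡-Reasoning

        y-below : SquareBelow y
        y-below = +-nonneg 0≤s 0≤δ , 0≤y-x⇒x≤y (subst (0# ≤ᵣ_) (sym t-y*y≡)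
          (+-nonneg (x≤y⇒0≤y-x (*-monoʳ-≤ δ 0≤δ δ≤1)) (*-nonneg 0≤t 0≤δ)))

        t≤s*s : t ≤ᵣ s * s
        t≤s*s = x-y≤0⇒x≤y (subst (_≤ᵣ 0#) (sym e≡G*δ) (*-nonpos G (≤-trans 0≤1 1≤2s+1+t) (x+y≤x⇒y≤0 (upper y y-below))))

      s*s≤t : (∀ b → (∀ x → SquareBelow x → x ≤ᵣ b) → s ≤ᵣ b) → s * s ≤ᵣ t
      s*s≤t least with total (s * s) t
      ... | inj₁ s²≤t = s²≤t
      ... | inj₂ t≤s² with nonneg-inverse (s + s + s + s) 1≤4s
      ...   | h , 4s*h≡1 , 0≤h = Overshoot.s*s≤t least t≤s² 4s*h≡1 0≤h

      t≤s*s : t ≤ᵣ s * s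
      t≤s*s with total (s * s) t
      ... | inj₂ t≤s² = t≤s²
      ... | inj₁ s²≤t with nonneg-inverse (s + s + 1# + t) 1≤2s+1+t
      ...   | g , G*g≡1 , 0≤g = Undershoot.t≤s*s s²≤t G*g≡1 0≤g

  ∃-sqrt : ∀ {t} → 1# ≤ᵣ t → ∃[ r ] (r * r ≡ t)
  ∃-sqrt {t} 1≤t with sup (SquareRoot.SquareBelow 1≤t) (0# , ≤-refl , subst (_≤ᵣ t) (sym (zeroˡ 0#)) (SquareRoot.0≤t 1≤t))
                          (t , SquareRoot.squareBelow⇒≤t 1≤t)
  ... | s , upper , least = s , antisym (SquareRoot.s*s≤t 1≤t upper least) (SquareRoot.t≤s*s 1≤t upper)

  ι≡0⇒≡0 : ∀ {i} → ι i ≡ 0# → i ≡ + 0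
  ι≡0⇒≡0 {+ zero}    _    = refl
  ι≡0⇒≡0 {+ (suc n)} ι≡0 = ⊥-elim (1≤x⇒x≢0 (1≤fromℕ-suc n) ι≡0)
  ι≡0⇒≡0 { -[1+ n ]} ι≡0 = ⊥-elim (1≤x⇒x≢0 (1≤fromℕ-suc n) (trans (sym (⁻¹-involutive _)) (trans (cong -_ ι≡0) ε⁻¹≈ε)))

  ι-injective : Injective _≡_ _≡_ ι
  ι-injective {i} {j} ιi≡ιj = ℤP.i-j≡0⇒i≡j i j (ι≡0⇒≡0 (trans (ι-sub i j) (trans (cong (_- ι j) ιi≡ιj) (-‿inverseʳ (ι j)))))

  *-cancelˡ : ∀ {x a b} → ¬ x ≡ 0# → x * a ≡ x * b → a ≡ b
  *-cancelˡ {x} {a} {b} x≢0 xa≡xb with inverse x x≢0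
  ... | y , xy≡1 = begin
    a              ≡⟨ *-identityˡ a ⟨
    1# * a         ≡⟨ cong (_* a) (trans (*-comm y x) xy≡1) ⟨
    y * x * a      ≡⟨ *-assoc y x a ⟩
    y * (x * a)    ≡⟨ cong (y *_) xa≡xb ⟩
    y * (x * b)    ≡⟨ *-assoc y x b ⟨
    y * x * b      ≡⟨ cong (_* b) (trans (*-comm y x) xy≡1) ⟩
    1# * b         ≡⟨ *-identityˡ b ⟩
    b              ∎
    where open ≡-Reasoning

  fromℕ≢0 : ∀ n .{{_ : ℕ.NonZero n}} → ¬ fromℕ R n ≡ 0#
  fromℕ≢0 (suc n) = 1≤x⇒x≢0 (1≤fromℕ-suc n)

  -- ι ((m + 2) * (m + 2) - 1) reduces to fromℕ of a successor.
  1≤ι[m*m-1] : ∀ {m} → 2 ℕ.≤ m → 1# ≤ᵣ ι (+ m ℤ.* + m ℤ.- + 1)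
  1≤ι[m*m-1] {suc (suc m)} (s≤s (s≤s _)) = 1≤fromℕ-suc (m ℕ.+ suc m ℕ.* suc (suc m))

  module Embedding (m n : ℕ) (2≤m : 2 ℕ.≤ m) .{{_ : ℕ.NonZero n}}
                   {r : ℝ} (r*r≡ : r * r ≡ ι (+ m ℤ.* + m ℤ.- + 1)) {w : ℝ} (n*w≡1 : fromℕ R n * w ≡ 1#) where

    r≢0 : ¬ r ≡ 0#
    r≢0 r≡0 = 1≤x⇒x≢0 (1≤ι[m*m-1] 2≤m) (trans (sym r*r≡) (trans (cong (λ z → z * z) r≡0) (zeroˡ 0#)))

    w≢0 : ¬ w ≡ 0#
    w≢0 w≡0 = 0≢1 (trans (sym (zeroʳ (fromℕ R n))) (trans (cong (fromℕ R n *_) (sym w≡0)) n*w≡1))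

    embed : ℤ² → Point R
    embed (x , y) = w * ι (shear (+ m) (x , y)) , w * (r * ι y)

    embed-injective : Injective _≡_ _≡_ embed
    embed-injective {xu , yu} {xv , yv} embed≡ = cong₂ _,_ xu≡xv yu≡yv
      where
      yu≡yv : yu ≡ yv
      yu≡yv = ι-injective (*-cancelˡ r≢0 (*-cancelˡ w≢0 (cong proj₂ embed≡)))
      xu≡xv : xu ≡ xv
      xu≡xv = ℤP.*-cancelˡ-≡ (+ m) xu xv {{ℕ.>-nonZero (ℕP.<⇒≤ 2≤m)}}
        (RingProperties.+-cancelʳ ℤP.+-*-ring yu _ _ (trans (ι-injective (*-cancelˡ w≢0 (cong proj₁ embed≡))) (cong (ℤ._+_ (+ m ℤ.* xv)) (sym yu≡yv))))

    embed-distance : ∀ u v a → Q (+ m) (v -ᶻ u) ≡ + a ℤ.* + a ℤ.* (+ n ℤ.* + n) →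
                     IsDistance R (embed u) (embed v) (fromℕ R a)
    embed-distance u@(xu , yu) v@(xv , yv) a Q≡ = fromℕ-nonneg a , sym (begin
      (w * ι pu - w * ι pv) * (w * ι pu - w * ι pv) + (w * (r * ι yu) - w * (r * ι yv)) * (w * (r * ι yu) - w * (r * ι yv))
        ≡⟨ solve 6 (λ w r pu pv yu yv →
             (w :* pu :- w :* pv) :* (w :* pu :- w :* pv) :+ (w :* (r :* yu) :- w :* (r :* yv)) :* (w :* (r :* yu) :- w :* (r :* yv))
             := w :* w :* ((pv :- pu) :* (pv :- pu) :+ r :* r :* ((yv :- yu) :* (yv :- yu)))) refl w r (ι pu) (ι pv) (ι yu) (ι yv) ⟩
      w * w * ((ι pv - ι pu) * (ι pv - ι pu) + r * r * ((ι yv - ι yu) * (ι yv - ι yu)))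
        ≡⟨ cong₂ (λ p y → w * w * (p * p + r * r * (y * y))) ιpv-ιpu≡ (sym (ι-sub yv yu)) ⟩
      w * w * (ι p * ι p + r * r * (ι Δy * ι Δy))
        ≡⟨ cong (λ t → w * w * (ι p * ι p + t * (ι Δy * ι Δy))) r*r≡ ⟩
      w * w * (ι p * ι p + ι (+ m ℤ.* + m ℤ.- + 1) * (ι Δy * ι Δy))
        ≡⟨ cong (w * w *_) (sym (ι-Q (+ m) (xv ℤ.- xu) Δy)) ⟩
      w * w * ι (Q (+ m) (v -ᶻ u))
        ≡⟨ cong (λ z → w * w * ι z) Q≡ ⟩
      w * w * ι (+ a ℤ.* + a ℤ.* (+ n ℤ.* + n))
        ≡⟨ cong (w * w *_) (trans (ι-* (+ a ℤ.* + a) (+ n ℤ.* + n)) (cong₂ _*_ (ι-* (+ a) (+ a)) (ι-* (+ n) (+ n)))) ⟩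
      w * w * (â * â * (n̂ * n̂))
        ≡⟨ solve 3 (λ w a n → w :* w :* (a :* a :* (n :* n)) := (n :* w) :* (n :* w) :* (a :* a)) refl w â n̂ ⟩
      n̂ * w * (n̂ * w) * (â * â)
        ≡⟨ cong (λ z → z * z * (â * â)) n*w≡1 ⟩
      1# * 1# * (â * â)
        ≡⟨ trans (cong (_* (â * â)) (*-identityˡ 1#)) (*-identityˡ (â * â)) ⟩
      â * â ∎)
      where
      open ≡-Reasoning
      â = fromℕ R a
      n̂ = fromℕ R n
      pu = shear (+ m) u
      pv = shear (+ m) v
      p = shear (+ m) (v -ᶻ u)
      Δy = yv ℤ.- yu
      ιpv-ιpu≡ : ι pv - ι pu ≡ ι p
      ιpv-ιpu≡ = trans (sym (ι-sub pv pu)) (cong ι (sym (shear-sub (+ m) u v)))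

  embedding : ∀ m n → 2 ℕ.≤ m → .{{_ : ℕ.NonZero n}} →
              ∃[ f ] (Injective _≡_ _≡_ f ×
                      (∀ u v a → Q (+ m) (v -ᶻ u) ≡ + a ℤ.* + a ℤ.* (+ n ℤ.* + n) → IsDistance R (f u) (f v) (fromℕ R a)))
  embedding m n 2≤m with ∃-sqrt (1≤ι[m*m-1] 2≤m) | inverse (fromℕ R n) (fromℕ≢0 n)
  ... | r , r*r≡ | w , n*w≡1 = embed , embed-injective , embed-distance
    where open Embedding m n 2≤m r*r≡ n*w≡1

lemma4 : (R : CompleteOrderedField) (q k : ℕ) → 1 ≤ q → 2 ≤ k →
    (A : ℕ → Set) → (∀ a → A a → 1 ≤ a) →
    ∃[ f ] (Injective _≡_ _≡_ f ×
    (∀ u v → CayleyAdj q k A u v → DistAdj R A (f u) (f v)))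
lemma4 R q k 1≤q _ A _
  with OrderedFieldTheory.embedding R (2 ℕ.* q ^ k) (N q k) (ℕP.*-monoʳ-≤ 2 (ℕP.m^n>0 q {{ℕ.>-nonZero 1≤q}} k)) {{N≢0 k 1≤q}}
... | f , f-injective , f-distance = f , f-injective , adjacent
  where
  adjacent : ∀ u v → CayleyAdj q k A u v → DistAdj R A (f u) (f v)
  adjacent u v uv with Q-∈±AD uv
  ... | a , Aa , Q≡ = a , Aa , f-distance u v a Q≡
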